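{- Let $w$ be a finite word and let $u$ be a primitive factor of $w$ with $uu\in\mathrm{Fac}(w)$; put $\ell=|u|$ and $M=M(u)$. Then for every integer $i\ge M$, \[ \mathbb{Q}\mathrm{Class}_w(u)\cap [u]_{2\ell+i}=\emptyset . \]
   Context: $\mathrm{Fac}(w)$ is the set of factors of $w$. A nonempty word is primitive if it is not $v^k$ for a word $v$ and an integer $k\ge2$. For a nonempty word $p$ and rational $m\ge 1$ with $m|p|$ an integer, $p^m$ denotes $p^{\lfloor m\rfloor}p_0$ with $p_0$ the prefix of $p$ such that $|p^m|=m|p|$. For a word $u$ of length $\ell$, $[u]$ is its conjugacy class (the words $yx$ with $u=xy$), and for an integer $i\ge 1$, $[u]_i$ denotes the set of factors of length $i$ of the infinite periodic word $u^\omega=uuu\cdots$ (so $[u]_\ell=[u]$). Define $\mathbb{Q}\mathrm{Class}_w(u)=\{p^m\in\mathrm{Fac}(w)\mid p\in[u],\ m\in\mathbb{Q},\ m\ge 2\}$. For $m\ge \ell$, the pair $C(u,m)=([u]_m,[u]_{m+1})$ is called a small circuit of the Rauzy graph $\Gamma_m(w)$ (vertices $\mathrm{Fac}(w)$ of length $m$, edges $\mathrm{Fac}(w)$ of length $m+1$) when $[u]_m\subseteq \mathrm{Fac}(w)$ and $[u]_{m+1}\subseteq\mathrm{Fac}(w)$. $M(u)$ is the number of integers $m\ge \ell$ for which $C(u,m)$ is a small circuit of $\Gamma_m(w)$; these are exactly $m=\ell,\ell+1,\dots,\ell+M(u)-1$. -}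

module Defs where

open import Data.List using (List; []; _∷_; _++_; length; take; concat; replicate)
open import Data.Nat using (ℕ; _≤_; _+_; _*_; suc)
open import Data.Product using (Σ; ∃; ∃-syntax; _×_; _,_)
open import Relation.Binary.PropositionalEquality using (_≡_; _≢_)
open import Relation.Nullary using (¬_)

module _ {A : Set} where

  _∈Fac_ : List A → List A → Set
  u ∈Fac w = ∃[ x ] ∃[ y ] (w ≡ x ++ u ++ y)

  _^_ : List A → ℕ → List A
  v ^ k = concat (replicate k v)

  Primitive : List A → Set
  Primitive u = (u ≢ []) × ¬ (∃[ v ] ∃[ k ] ((2 ≤ k) × (u ≡ v ^ k)))

  _∈Conj_ : List A → List A → Set
  p ∈Conj u = ∃[ x ] ∃[ y ] ((u ≡ x ++ y) × (p ≡ y ++ x))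

  -- [u]_i : factors of length i of u^ω  (u nonempty); the factors of u^ω
  -- are exactly the factors of the finite powers u^n
  _∈Per[_]_ : List A → List A → ℕ → Set
  v ∈Per[ u ] i = (length v ≡ i) × ∃[ n ] (v ∈Fac (u ^ n))

  -- fractional power p^m, parametrised by its length n = m|p|:
  -- the prefix of length n of p^ω (= p^⌊m⌋ p₀); for nonempty p,
  -- p ^ n has length ≥ n
  fracPow : List A → ℕ → List A
  fracPow p n = take n (p ^ n)

  -- ℚClass_w(u) = { p^m ∈ Fac(w) | p ∈ [u], m ∈ ℚ, m ≥ 2 }
  -- (m ≥ 2 ⇔ the length n = m|p| satisfies 2|p| ≤ n)
  _∈QClass[_]_ : List A → List A → List A → Set
  q ∈QClass[ w ] u =
    (q ∈Fac w) × ∃[ p ] ∃[ n ] ((p ∈Conj u) × (2 * length p ≤ n) × (q ≡ fracPow p n))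

  -- C(u,m) is a small circuit of the Rauzy graph Γ_m(w)
  SmallCircuit : List A → List A → ℕ → Set
  SmallCircuit w u m =
    (length u ≤ m)
    × (∀ v → v ∈Per[ u ] m → v ∈Fac w)
    × (∀ v → v ∈Per[ u ] (suc m) → v ∈Fac w)

{-# OPTIONS --safe #-}
module Submission where

-- Suppose q ∈ Fac(w) is the prefix of length 2ℓ + i of p^ω for a conjugate p
-- of u. A factor of u^ω of length k ≤ ℓ + i + 1 occurs in p^ω at an offset
-- below |p| = ℓ, so it ends within the first ℓ - 1 + k ≤ |q| letters, i.e.
-- inside q, and thus in w. Hence C(u, m) is a small circuit for each of the
-- i + 1 values m = ℓ, …, ℓ + i, so M(u) ≥ i + 1.

open import Defs
open import Data.List using (List; []; _∷_; _++_; length; take; lookup)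
open import Data.List.Properties using (++-assoc; ++-identityʳ; length-++; length-++-comm; length-take; take-all; ∷-injective)
open import Data.List.Relation.Unary.Unique.Propositional using (Unique)
open import Data.List.Membership.Propositional using (_∈_)
open import Data.List.Relation.Unary.Any using (index)
open import Data.List.Relation.Unary.Any.Properties using (lookup-index)
open import Data.Nat using (ℕ; zero; suc; _+_; _*_; _∸_; _≤_; _<_; s≤s; s≤s⁻¹; z≤n; _<?_)
open import Data.Nat.Properties
open import Data.Fin using (Fin; toℕ)
open import Data.Fin.Properties using (toℕ-injective; toℕ<n; injective⇒≤)
open import Data.Empty using (⊥)
open import Data.Product using (∃-syntax; _×_; _,_)
open import Function.Bundles using (_⇔_; Equivalence)
open import Function.Definitions using (Injective)
open import Relation.Nullary using (yes; no; contradiction)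
open import Relation.Binary.PropositionalEquality

module _ {A : Set} where

  ≢[]⇒0<length : {xs : List A} → xs ≢ [] → 0 < length xs
  ≢[]⇒0<length {[]}    xs≢[] = contradiction refl xs≢[]
  ≢[]⇒0<length {_ ∷ _} _     = s≤s z≤n

  ^-+ : ∀ (p : List A) m n → p ^ (m + n) ≡ p ^ m ++ p ^ n
  ^-+ p zero    n = refl
  ^-+ p (suc m) n = trans (cong (p ++_) (^-+ p m n)) (sym (++-assoc p (p ^ m) (p ^ n)))

  length-^ : ∀ (p : List A) n → length (p ^ n) ≡ n * length p
  length-^ p zero    = refl
  length-^ p (suc n) = trans (length-++ p) (cong (length p +_) (length-^ p n))

  n≤length-^ : ∀ {p : List A} n → 0 < length p → n ≤ length (p ^ n)
  n≤length-^ {p} n 0<p = begin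
    n                 ≡⟨ *-identityʳ n ⟨
    n * 1             ≤⟨ *-monoʳ-≤ n 0<p ⟩
    n * length p      ≡⟨ length-^ p n ⟨
    length (p ^ n)    ∎
    where open ≤-Reasoning

  ^-rotate : ∀ (x y : List A) N → (y ++ x) ^ suc N ≡ y ++ (x ++ y) ^ N ++ x
  ^-rotate x y zero    = ++-identityʳ (y ++ x)
  ^-rotate x y (suc N) = begin
    (y ++ x) ++ (y ++ x) ^ suc N            ≡⟨ cong ((y ++ x) ++_) (^-rotate x y N) ⟩
    (y ++ x) ++ y ++ (x ++ y) ^ N ++ x      ≡⟨ ++-assoc y x _ ⟩
    y ++ x ++ y ++ (x ++ y) ^ N ++ x        ≡⟨ cong (y ++_) (++-assoc x y _) ⟨
    y ++ (x ++ y) ++ (x ++ y) ^ N ++ x      ≡⟨ cong (y ++_) (++-assoc (x ++ y) _ x) ⟨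
    y ++ ((x ++ y) ++ (x ++ y) ^ N) ++ x    ∎
    where open ≡-Reasoning

  take-++ : ∀ n (xs ys : List A) → take n (xs ++ ys) ≡ take n xs ++ take (n ∸ length xs) ys
  take-++ zero    []       ys = refl
  take-++ zero    (x ∷ xs) ys = refl
  take-++ (suc n) []       ys = refl
  take-++ (suc n) (x ∷ xs) ys = cong (x ∷_) (take-++ n xs ys)

  take-++-≤ : ∀ {n} (xs ys : List A) → n ≤ length xs → take n (xs ++ ys) ≡ take n xs
  take-++-≤ {n} xs ys n≤xs = begin
    take n (xs ++ ys)                          ≡⟨ take-++ n xs ys ⟩
    take n xs ++ take (n ∸ length xs) ys       ≡⟨ cong (λ k → take n xs ++ take k ys) (m≤n⇒m∸n≡0 n≤xs) ⟩
    take n xs ++ []                            ≡⟨ ++-identityʳ (take n xs) ⟩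
    take n xs                                  ∎
    where open ≡-Reasoning

  take-++-≥ : ∀ {n} (xs ys : List A) → length xs ≤ n → take n (xs ++ ys) ≡ xs ++ take (n ∸ length xs) ys
  take-++-≥ {n} xs ys xs≤n = trans (take-++ n xs ys) (cong (_++ take (n ∸ length xs) ys) (take-all n xs xs≤n))

  length-fracPow≤ : ∀ (p : List A) n → length (fracPow p n) ≤ n
  length-fracPow≤ p n = subst (_≤ n) (sym (length-take n (p ^ n))) (m⊓n≤m n _)

  fracPow-≡-take-^-++ : ∀ (p : List A) K n → 0 < length p → fracPow p n ≡ take n (p ^ K ++ p ^ n)
  fracPow-≡-take-^-++ p K n 0<p = begin
    take n (p ^ n)              ≡⟨ take-++-≤ (p ^ n) (p ^ K) (n≤length-^ n 0<p) ⟨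
    take n (p ^ n ++ p ^ K)     ≡⟨ cong (take n) (^-+ p n K) ⟨
    take n (p ^ (n + K))        ≡⟨ cong (λ k → take n (p ^ k)) (+-comm n K) ⟩
    take n (p ^ (K + n))        ≡⟨ cong (take n) (^-+ p K n) ⟩
    take n (p ^ K ++ p ^ n)     ∎
    where open ≡-Reasoning

  ∈Fac-trans : {u v w : List A} → u ∈Fac v → v ∈Fac w → u ∈Fac w
  ∈Fac-trans {u} (x′ , y′ , refl) (x , y , refl) = x ++ x′ , y′ ++ y , (begin
    x ++ (x′ ++ u ++ y′) ++ y       ≡⟨ cong (x ++_) (++-assoc x′ (u ++ y′) y) ⟩
    x ++ x′ ++ (u ++ y′) ++ y       ≡⟨ cong (λ s → x ++ x′ ++ s) (++-assoc u y′ y) ⟩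
    x ++ x′ ++ u ++ y′ ++ y         ≡⟨ ++-assoc x x′ _ ⟨
    (x ++ x′) ++ u ++ y′ ++ y       ∎)
    where open ≡-Reasoning

  ∈Fac-take : ∀ n (z v b : List A) → length z + length v ≤ n → v ∈Fac take n (z ++ v ++ b)
  ∈Fac-take n z v b z+v≤n = z , take (n ∸ length z ∸ length v) b , (begin
    take n (z ++ v ++ b)                           ≡⟨ take-++-≥ z (v ++ b) (m+n≤o⇒m≤o (length z) z+v≤n) ⟩
    z ++ take (n ∸ length z) (v ++ b)              ≡⟨ cong (z ++_) (take-++-≥ v b v≤n-z) ⟩
    z ++ v ++ take (n ∸ length z ∸ length v) b     ∎)
    where
    open ≡-Reasoning
    v≤n-z : length v ≤ n ∸ length z
    v≤n-z = m+n≤o⇒m≤o∸n (length v) (subst (_≤ n) (+-comm (length z) (length v)) z+v≤n)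

  ++-≡-++-split : ∀ (u a : List A) {t t′} → u ++ t′ ≡ a ++ t → length u ≤ length a
                → ∃[ a′ ] (a ≡ u ++ a′ × t′ ≡ a′ ++ t)
  ++-≡-++-split []      a       eq _        = a , refl , eq
  ++-≡-++-split (_ ∷ u) (_ ∷ a) eq (s≤s u≤a) with ∷-injective eq
  ... | refl , eq′ with ++-≡-++-split u a eq′ u≤a
  ...   | a′ , refl , eq″ = a′ , refl , eq″

  ^-occurrence-within-period : ∀ (p : List A) {v} K z b → 0 < length p → p ^ K ≡ z ++ v ++ b
    → ∃[ K′ ] ∃[ z′ ] ∃[ b′ ] (length z′ < length p × p ^ K′ ≡ z′ ++ v ++ b′)
  ^-occurrence-within-period p zero    []      b 0<p eq = zero , [] , b , 0<p , eq
  ^-occurrence-within-period p (suc K) z       b 0<p eq with length z <? length p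
  ... | yes z<p = suc K , z , b , z<p , eq
  ... | no  z≮p with ++-≡-++-split p z eq (≮⇒≥ z≮p)
  ...   | z′ , refl , eq′ = ^-occurrence-within-period p K z′ b 0<p eq′

  ∈Fac-^⇒∈Fac-fracPow : ∀ (p : List A) {v} K n → 0 < length p → v ∈Fac (p ^ K)
    → length p + length v ≤ suc n → v ∈Fac fracPow p n
  ∈Fac-^⇒∈Fac-fracPow p {v} K n 0<p (z , b , eq) p+v≤1+n
    with ^-occurrence-within-period p K z b 0<p eq
  ... | K′ , z′ , b′ , z′<p , eq′ =
    subst (v ∈Fac_) (sym fracPow≡) (∈Fac-take n z′ v (b′ ++ p ^ n) z′+v≤n)
    where
    open ≡-Reasoning
    z′+v≤n : length z′ + length v ≤ n
    z′+v≤n = s≤s⁻¹ (≤-trans (+-monoˡ-≤ (length v) z′<p) p+v≤1+n)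
    fracPow≡ : fracPow p n ≡ take n (z′ ++ v ++ b′ ++ p ^ n)
    fracPow≡ = begin
      fracPow p n                       ≡⟨ fracPow-≡-take-^-++ p K′ n 0<p ⟩
      take n (p ^ K′ ++ p ^ n)          ≡⟨ cong (λ s → take n (s ++ p ^ n)) eq′ ⟩
      take n ((z′ ++ v ++ b′) ++ p ^ n) ≡⟨ cong (take n) (++-assoc z′ (v ++ b′) (p ^ n)) ⟩
      take n (z′ ++ (v ++ b′) ++ p ^ n) ≡⟨ cong (λ s → take n (z′ ++ s)) (++-assoc v b′ (p ^ n)) ⟩
      take n (z′ ++ v ++ b′ ++ p ^ n)   ∎

  ∈Per⇒∈Fac-fracPow : ∀ {u p v : List A} {k} n → 0 < length u → p ∈Conj u → v ∈Per[ u ] k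
    → length u + k ≤ suc n → v ∈Fac fracPow p n
  ∈Per⇒∈Fac-fracPow n 0<u (x , y , refl , refl) (refl , N , v∈[xy]^N) u+v≤1+n =
    ∈Fac-^⇒∈Fac-fracPow (y ++ x) (suc N) n
      (subst (0 <_) |xy|≡|yx| 0<u)
      (∈Fac-trans v∈[xy]^N (y , x , ^-rotate x y N))
      (subst (λ l → l + _ ≤ suc n) |xy|≡|yx| u+v≤1+n)
    where
    |xy|≡|yx| : length (x ++ y) ≡ length (y ++ x)
    |xy|≡|yx| = length-++-comm x y

  fracPow-smallCircuit : ∀ {w u p : List A} {n m} → 0 < length u → p ∈Conj u → fracPow p n ∈Fac w
    → length u ≤ m → length u + m ≤ n → SmallCircuit w u m
  fracPow-smallCircuit {u = u} {n = n} {m} 0<u p∈[u] q∈w u≤m u+m≤n =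
      u≤m
    , (λ v v∈ → ∈Fac-trans (∈Per⇒∈Fac-fracPow n 0<u p∈[u] v∈ (m≤n⇒m≤1+n u+m≤n)) q∈w)
    , (λ v v∈ → ∈Fac-trans (∈Per⇒∈Fac-fracPow n 0<u p∈[u] v∈ u+[1+m]≤1+n) q∈w)
    where
    u+[1+m]≤1+n : length u + suc m ≤ suc n
    u+[1+m]≤1+n = subst (_≤ suc n) (sym (+-suc (length u) m)) (s≤s u+m≤n)

injective-∈⇒≤length : ∀ {B : Set} {k} {xs : List B} {f : Fin k → B}
  → Injective _≡_ _≡_ f → (∀ t → f t ∈ xs) → k ≤ length xs
injective-∈⇒≤length {xs = xs} {f} f-inj f∈xs = injective⇒≤ λ {s} {t} eq → f-inj (begin
  f s                         ≡⟨ lookup-index (f∈xs s) ⟩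
  lookup xs (index (f∈xs s))  ≡⟨ cong (lookup xs) eq ⟩
  lookup xs (index (f∈xs t))  ≡⟨ lookup-index (f∈xs t) ⟨
  f t                         ∎)
  where open ≡-Reasoning

lemma5 : {A : Set} (w u : List A) → Primitive u → u ∈Fac w → (u ++ u) ∈Fac w
    → (ms : List ℕ) → Unique ms → (∀ m → (m ∈ ms) ⇔ SmallCircuit w u m)
    → ∀ i → length ms ≤ i
    → ∀ q → q ∈QClass[ w ] u → q ∈Per[ u ] (2 * length u + i) → ⊥
lemma5 w u (u≢[] , _) _ _ ms _ ms⇔circuit i |ms|≤i q (q∈w , p , n , p∈[u] , _ , refl) (|q|≡2ℓ+i , _) =
  1+n≰n (≤-trans (injective-∈⇒≤length shift-injective circuit∈ms) |ms|≤i)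
  where
  ℓ : ℕ
  ℓ = length u
  2ℓ+i≤n : 2 * ℓ + i ≤ n
  2ℓ+i≤n = subst (_≤ n) |q|≡2ℓ+i (length-fracPow≤ p n)
  ℓ+[ℓ+t]≤n : (t : Fin (suc i)) → ℓ + (ℓ + toℕ t) ≤ n
  ℓ+[ℓ+t]≤n t = begin
    ℓ + (ℓ + toℕ t)   ≤⟨ +-monoʳ-≤ ℓ (+-monoʳ-≤ ℓ (s≤s⁻¹ (toℕ<n t))) ⟩
    ℓ + (ℓ + i)       ≡⟨ +-assoc ℓ ℓ i ⟨
    ℓ + ℓ + i         ≡⟨ cong (λ k → ℓ + k + i) (+-identityʳ ℓ) ⟨
    2 * ℓ + i         ≤⟨ 2ℓ+i≤n ⟩
    n                 ∎
    where open ≤-Reasoning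
  circuit∈ms : (t : Fin (suc i)) → ℓ + toℕ t ∈ ms
  circuit∈ms t = Equivalence.from (ms⇔circuit (ℓ + toℕ t))
    (fracPow-smallCircuit (≢[]⇒0<length u≢[]) p∈[u] q∈w (m≤m+n ℓ (toℕ t)) (ℓ+[ℓ+t]≤n t))
  shift-injective : Injective _≡_ _≡_ (λ (t : Fin (suc i)) → ℓ + toℕ t)
  shift-injective eq = toℕ-injective (+-cancelˡ-≡ ℓ _ _ eq)
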